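{- Let $r\ge 3t$, let $\mathcal H$ be an $(r,t)$-graph, and let $e_1,e_2,e_3\in E(\mathcal H)$. Set $t_1=|e_1\cap e_2\cap e_3|$ and $t_2=|(e_1\cap e_2)\setminus e_3|+|(e_1\cap e_3)\setminus e_2|+|(e_2\cap e_3)\setminus e_1|$. Then \[ \tau(\mathcal H)\le\begin{cases} \frac13(2t_1+t_2+r-3t+3) & \text{if } r-3t+1+t_2\le t_1\le r,\\[2pt] r-3t+1+t_2 & \text{if } r-3t+1-t_2\le t_1\le r-3t+1+t_2,\\[2pt] 3r-2t_1-t_2-9t+3 & \text{if } 0\le t_1\le r-3t+1-t_2. \end{cases}\]
   Context: All hypergraphs are finite. An $r$-uniform hypergraph $\mathcal H$ is $r$-partite if its vertex set can be partitioned as $V(\mathcal H)=P_1\sqcup\dots\sqcup P_r$ such that $|e\cap P_j|=1$ for every edge $e$ and every $j\in[r]$. It is $t$-intersecting if $|e\cap f|\ge t$ for all $e,f\in E(\mathcal H)$. An $(r,t)$-graph is an $r$-uniform, $r$-partite, $t$-intersecting hypergraph. A cover of $\mathcal H$ is a set $C\subseteq V(\mathcal H)$ with $C\cap e\neq\emptyset$ for every edge $e$; the cover number $\tau(\mathcal H)$ is the minimum size of a cover. -}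

module Defs where

open import Data.Nat using (ℕ; _≤_; _+_; _*_)
open import Data.Fin using (Fin; _≟_)
open import Data.Fin.Subset using (Subset; _∈_; _∩_; _─_; ∣_∣)
open import Data.Vec using (tabulate)
open import Data.Product using (Σ; _×_; ∃)
open import Relation.Nullary.Decidable using (⌊_⌋)
open import Relation.Binary.PropositionalEquality using (_≡_)

record Hypergraph : Set where
  field
    n : ℕ
    m : ℕ
    E : Fin m → Subset n
open Hypergraph public

Part : ∀ {n r} → (Fin n → Fin r) → Fin r → Subset n
Part part j = tabulate (λ v → ⌊ part v ≟ j ⌋)

Uniform : ℕ → Hypergraph → Set
Uniform r H = ∀ i → ∣ E H i ∣ ≡ r

Partite : ℕ → Hypergraph → Set
Partite r H = Σ (Fin (n H) → Fin r) λ part → ∀ i j → ∣ E H i ∩ Part part j ∣ ≡ 1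

Intersecting : ℕ → Hypergraph → Set
Intersecting t H = ∀ i j → t ≤ ∣ E H i ∩ E H j ∣

RTGraph : ℕ → ℕ → Hypergraph → Set
RTGraph r t H = Uniform r H × Partite r H × Intersecting t H

IsCover : (H : Hypergraph) → Subset (n H) → Set
IsCover H C = ∀ i → ∃ λ v → v ∈ C × v ∈ E H i

IsCoverNumber : Hypergraph → ℕ → Set
IsCoverNumber H k = (Σ (Subset (n H)) λ C → IsCover H C × ∣ C ∣ ≡ k)
                  × (∀ C → IsCover H C → k ≤ ∣ C ∣)

-- In every part P_j the three edges meet P_j in at most three vertices.  Give each vertex its
-- degree d(v), the number of e₁, e₂, e₃ containing it, and for thresholds κ_j put
-- C_κ = {v : d(v) > κ_(part v)}.  An edge f missing C_κ meets e₁, e₂, e₃ in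
-- Σ_(v ∈ f) d(v) ≤ Σ_j κ_j points in total, so C_κ is a cover once Σ_j κ_j < 3t.  The size of
-- C_κ is a sum over the parts, depending only on whether in P_j the three edges share their
-- vertex (t₁ parts), exactly two of them do (t₂ parts), or none do.  The budget Σ κ_j = 3t − 1 is best
-- spent first on parts where all three differ (one unit of weight saves three vertices), then
-- on parts with two agreeing (one saves one), then on common parts (three save one); the three
-- cases of the bound are where this greedy allocation stops.
module Submission where

open import Defs
open import Data.Nat.Properties using (+-0-commutativeMonoid)
open import Algebra.Properties.CommutativeMonoid.Sum +-0-commutativeMonoid
  using (sum; sum-cong-≗; ∑-distrib-+; ∑-comm; sum-replicate-zero)
open import Data.Bool using (Bool; true; false; _∧_; _∨_; not; T)
import Data.Bool.Properties as Bool
open import Data.Fin using (Fin; zero; suc; _≟_)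
open import Data.Fin.Properties using (any?)
open import Data.Fin.Subset using (Subset; _∩_; _─_; ∣_∣)
open import Data.Nat using (ℕ; zero; suc; _+_; _*_; _∸_; _≤_; _<_; _<ᵇ_; z≤n; s≤s)
open import Data.Nat.Properties
  using (≤-refl; ≤-trans; ≤-reflexive; ≤-pred; n≤1+n; +-mono-≤; +-monoˡ-≤; +-monoʳ-≤;
         *-monoʳ-≤; +-identityʳ; +-comm; *-comm; +-cancelˡ-≤; m≤n+m; m≤n*m; m+[n∸m]≡n;
         ≮⇒≥; ≤⇒≯; <⇒<ᵇ; <⇒≱; suc-injective; m+n≡0⇒m≡0; m+n≡0⇒n≡0; *-suc; module ≤-Reasoning)
open import Data.Nat.DivMod using (_/_; _%_; m≡m%n+[m/n]*n; m%n<n; m/n≤m; m/n*n≤m)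
open import Data.Nat.Tactic.RingSolver using (solve-∀)
open import Data.Product using (∃; _×_; _,_; proj₁; proj₂)
open import Data.Vec using (_∷_; []; lookup; tabulate)
open import Data.Vec.Properties using (lookup∘tabulate; lookup⇒[]=; lookup-zipWith)
import Data.Vec.Functional as Vector
open import Function using (_∘_)
open import Function.Bundles using (mk⇔)
open import Relation.Binary.PropositionalEquality
  using (_≡_; _≗_; refl; sym; trans; cong; cong₂; subst; subst₂; module ≡-Reasoning)
open import Relation.Nullary using (yes; no; does; contradiction)
open import Relation.Nullary.Decidable using (dec-true; dec-false; does-⇔; isYes≗does)

𝟙 : Bool → ℕ
𝟙 true  = 1
𝟙 false = 0

_==_ : ∀ {n} → Fin n → Fin n → Bool
x == y = does (x ≟ y)

==-sym : ∀ {n} (x y : Fin n) → (x == y) ≡ (y == x)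
==-sym x y = does-⇔ (mk⇔ sym sym) (x ≟ y) (y ≟ x)

==-refl : ∀ {n} (x : Fin n) → (x == x) ≡ true
==-refl x = dec-true (x ≟ x) refl

==⇒≡ : ∀ {n} {x y : Fin n} → (x == y) ≡ true → x ≡ y
==⇒≡ {x = x} {y} x==y with x ≟ y
... | yes x≡y = x≡y

<ᵇ≡false⇒≤ : ∀ m n → (m <ᵇ n) ≡ false → n ≤ m
<ᵇ≡false⇒≤ m n m≮n = ≮⇒≥ (λ m<n → subst T m≮n (<⇒<ᵇ m<n))

sum-mono-≤ : ∀ {k} {f g : Fin k → ℕ} → (∀ j → f j ≤ g j) → sum f ≤ sum g
sum-mono-≤ {zero}  f≤g = z≤n
sum-mono-≤ {suc k} f≤g = +-mono-≤ (f≤g zero) (sum-mono-≤ (f≤g ∘ suc))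

sum-distrib₃ : ∀ {k} (f g h : Fin k → ℕ) →
               sum (λ j → f j + g j + h j) ≡ sum f + sum g + sum h
sum-distrib₃ f g h =
  trans (∑-distrib-+ (λ j → f j + g j) h) (cong (_+ sum h) (∑-distrib-+ f g))

sum-ones : ∀ k → sum {k} (λ _ → 1) ≡ k
sum-ones zero    = refl
sum-ones (suc k) = cong suc (sum-ones k)

sum-δ : ∀ {k} (u : Fin k) (f : Fin k → ℕ) → sum (λ v → 𝟙 (u == v) * f v) ≡ f u
sum-δ {suc k} zero    f = begin
  f zero + 0 + sum {k} (λ _ → 0) ≡⟨ cong (f zero + 0 +_) (sum-replicate-zero k) ⟩
  f zero + 0 + 0                 ≡⟨ trans (+-identityʳ _) (+-identityʳ _) ⟩
  f zero                         ∎
  where open ≡-Reasoning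
sum-δ {suc k} (suc u) f = sum-δ u (f ∘ suc)

sum-𝟙≡suc⇒∃ : ∀ {k m} (f : Fin k → Bool) → sum (λ v → 𝟙 (f v)) ≡ suc m → ∃ λ v → f v ≡ true
sum-𝟙≡suc⇒∃ {suc k} f eq with f zero in f0
... | true  = zero , f0
... | false = let v , fv = sum-𝟙≡suc⇒∃ (f ∘ suc) eq in suc v , fv

1≤sum-𝟙 : ∀ {k} (f : Fin k → Bool) {u} → f u ≡ true → 1 ≤ sum (λ v → 𝟙 (f v))
1≤sum-𝟙 f {zero}  fu rewrite fu = s≤s z≤n
1≤sum-𝟙 f {suc u} fu = ≤-trans (1≤sum-𝟙 (f ∘ suc) fu) (m≤n+m _ (𝟙 (f zero)))

sum-𝟙≤1⇒unique : ∀ {k} (f : Fin k → Bool) → sum (λ v → 𝟙 (f v)) ≤ 1 →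
                 ∀ {u w} → f u ≡ true → f w ≡ true → u ≡ w
sum-𝟙≤1⇒unique f ≤1 {zero}  {zero}  fu fw = refl
sum-𝟙≤1⇒unique f ≤1 {zero}  {suc w} fu fw rewrite fu =
  contradiction (s≤s (1≤sum-𝟙 (f ∘ suc) fw)) (<⇒≱ (s≤s ≤1))
sum-𝟙≤1⇒unique f ≤1 {suc u} {zero}  fu fw rewrite fw =
  contradiction (s≤s (1≤sum-𝟙 (f ∘ suc) fu)) (<⇒≱ (s≤s ≤1))
sum-𝟙≤1⇒unique f ≤1 {suc u} {suc w} fu fw =
  cong suc (sum-𝟙≤1⇒unique (f ∘ suc) (≤-trans (m≤n+m _ (𝟙 (f zero))) ≤1) fu fw)

∣p∣≡sum : ∀ {n} (p : Subset n) → ∣ p ∣ ≡ sum (λ v → 𝟙 (lookup p v))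
∣p∣≡sum []          = refl
∣p∣≡sum (true  ∷ p) = cong suc (∣p∣≡sum p)
∣p∣≡sum (false ∷ p) = ∣p∣≡sum p

∣p∩q∣≡sum : ∀ {n} (p q : Subset n) → ∣ p ∩ q ∣ ≡ sum (λ v → 𝟙 (lookup p v ∧ lookup q v))
∣p∩q∣≡sum p q = trans (∣p∣≡sum (p ∩ q)) (sum-cong-≗ (cong 𝟙 ∘ λ v → lookup-zipWith _∧_ v p q))

∣p∩q∩s∣≡sum : ∀ {n} (p q s : Subset n) →
              ∣ p ∩ q ∩ s ∣ ≡ sum (λ v → 𝟙 (lookup p v ∧ (lookup q v ∧ lookup s v)))
∣p∩q∩s∣≡sum p q s = trans (∣p∩q∣≡sum p (q ∩ s))
  (sum-cong-≗ λ v → cong (λ b → 𝟙 (lookup p v ∧ b)) (lookup-zipWith _∧_ v q s))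

lookup-∩─ : ∀ {n} (p q s : Subset n) v →
            lookup ((p ∩ q) ─ s) v ≡ lookup p v ∧ (lookup q v ∧ not (lookup s v))
lookup-∩─ (x ∷ p) (y ∷ q) (true  ∷ s) zero = sym (trans (cong (x ∧_) (Bool.∧-zeroʳ y)) (Bool.∧-zeroʳ x))
lookup-∩─ (x ∷ p) (y ∷ q) (false ∷ s) zero = cong (x ∧_) (sym (Bool.∧-identityʳ y))
lookup-∩─ (x ∷ p) (y ∷ q) (z ∷ s) (suc v) = lookup-∩─ p q s v

∣p∩q─s∣≡sum : ∀ {n} (p q s : Subset n) →
              ∣ (p ∩ q) ─ s ∣ ≡ sum (λ v → 𝟙 (lookup p v ∧ (lookup q v ∧ not (lookup s v))))
∣p∩q─s∣≡sum p q s = trans (∣p∣≡sum ((p ∩ q) ─ s)) (sum-cong-≗ (cong 𝟙 ∘ lookup-∩─ p q s))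

∣p∩Part∣≡sum : ∀ {n r} (p : Subset n) (part : Fin n → Fin r) j →
               ∣ p ∩ Part part j ∣ ≡ sum (λ v → 𝟙 (lookup p v ∧ part v == j))
∣p∩Part∣≡sum p part j = trans (∣p∩q∣≡sum p (Part part j))
  (sum-cong-≗ λ v → cong (λ b → 𝟙 (lookup p v ∧ b))
    (trans (lookup∘tabulate _ v) (isYes≗does (part v ≟ j))))

record Transversal {n r} (part : Fin n → Fin r) (e : Fin n → Bool) : Set where
  field
    pick      : Fin r → Fin n
    pick-∈    : ∀ j → e (pick j) ≡ true
    part-pick : ∀ j → part (pick j) ≡ j
    pick-part : ∀ v → e v ≡ true → pick (part v) ≡ v

open Transversal

transversal : ∀ {n r} (part : Fin n → Fin r) (e : Fin n → Bool) →
              (∀ j → sum (λ v → 𝟙 (e v ∧ part v == j)) ≡ 1) → Transversal part e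
transversal {n} {r} part e one-per-part = record
  { pick      = λ j → proj₁ (chosen j)
  ; pick-∈    = λ j → Bool.∧-conicalˡ _ _ (proj₂ (chosen j))
  ; part-pick = λ j → ==⇒≡ (Bool.∧-conicalʳ _ _ (proj₂ (chosen j)))
  ; pick-part = λ v ev → sum-𝟙≤1⇒unique (inPart (part v)) (≤-reflexive (one-per-part (part v)))
                           (proj₂ (chosen (part v))) (cong₂ _∧_ ev (==-refl (part v)))
  }
  where
  inPart : Fin r → Fin n → Bool
  inPart j v = e v ∧ part v == j
  chosen : ∀ j → ∃ λ v → inPart j v ≡ true
  chosen j = sum-𝟙≡suc⇒∃ (inPart j) (one-per-part j)

module _ {n r} {part : Fin n → Fin r} {e : Fin n → Bool} (σ : Transversal part e) where

  ∈≡picked : ∀ v → e v ≡ (pick σ (part v) == v)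
  ∈≡picked v with e v in ev | pick σ (part v) ≟ v
  ... | true  | yes _    = refl
  ... | true  | no p≢v   = contradiction (pick-part σ v ev) p≢v
  ... | false | yes p≡v with () ← trans (sym ev) (subst (λ u → e u ≡ true) p≡v (pick-∈ σ (part v)))
  ... | false | no _     = refl

  ∈≡agree : ∀ {e'} (σ' : Transversal part e') j → e (pick σ' j) ≡ (pick σ j == pick σ' j)
  ∈≡agree σ' j = trans (∈≡picked (pick σ' j)) (cong (λ i → pick σ i == pick σ' j) (part-pick σ' j))

  count-via-pick : ∀ g → sum (λ v → 𝟙 (e v ∧ g v)) ≡ sum (λ j → 𝟙 (g (pick σ j)))
  count-via-pick g = begin
    sum (λ v → 𝟙 (e v ∧ g v))                                      ≡⟨ sum-cong-≗ spread ⟩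
    sum (λ v → sum (λ j → 𝟙 (pick σ j == v) * 𝟙 (g (pick σ j))))  ≡⟨ ∑-comm (λ v j → 𝟙 (pick σ j == v) * 𝟙 (g (pick σ j))) ⟩
    sum (λ j → sum (λ v → 𝟙 (pick σ j == v) * 𝟙 (g (pick σ j))))  ≡⟨ sum-cong-≗ (λ j → sum-δ (pick σ j) _) ⟩
    sum (λ j → 𝟙 (g (pick σ j)))                                   ∎
    where
    open ≡-Reasoning
    spread : ∀ v → 𝟙 (e v ∧ g v) ≡ sum (λ j → 𝟙 (pick σ j == v) * 𝟙 (g (pick σ j)))
    spread v with e v in ev
    ... | true = sym (begin
      sum (λ j → 𝟙 (pick σ j == v) * 𝟙 (g (pick σ j)))
        ≡⟨ sum-cong-≗ (λ j → cong (λ b → 𝟙 b * 𝟙 (g (pick σ j)))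
             (does-⇔ (mk⇔ (λ { refl → part-pick σ j })
                          (λ { refl → pick-part σ v ev })) (pick σ j ≟ v) (part v ≟ j))) ⟩
      sum (λ j → 𝟙 (part v == j) * 𝟙 (g (pick σ j)))   ≡⟨ sum-δ (part v) _ ⟩
      𝟙 (g (pick σ (part v)))                          ≡⟨ cong (𝟙 ∘ g) (pick-part σ v ev) ⟩
      𝟙 (g v)                                           ∎)
    ... | false = sym (trans (sum-cong-≗ (λ j → cong (λ b → 𝟙 b * 𝟙 (g (pick σ j)))
                               (dec-false (pick σ j ≟ v) λ { refl → contradiction (trans (sym ev) (pick-∈ σ j)) λ () })))
                             (sum-replicate-zero r))

data Kind : Set where
  allSame twoSame allDifferent : Kind

_==ᴷ_ : Kind → Kind → Bool
allSame      ==ᴷ allSame      = true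
twoSame      ==ᴷ twoSame      = true
allDifferent ==ᴷ allDifferent = true
_            ==ᴷ _            = false

count : ∀ {r} → (Fin r → Kind) → Kind → ℕ
count ks k = sum (λ j → 𝟙 (ks j ==ᴷ k))

count-partition : ∀ {r} (ks : Fin r → Kind) →
                  count ks allSame + count ks twoSame + count ks allDifferent ≡ r
count-partition {r} ks = begin
  count ks allSame + count ks twoSame + count ks allDifferent
    ≡⟨ sum-distrib₃ (λ j → 𝟙 (ks j ==ᴷ allSame)) (λ j → 𝟙 (ks j ==ᴷ twoSame)) (λ j → 𝟙 (ks j ==ᴷ allDifferent)) ⟨
  sum (λ j → 𝟙 (ks j ==ᴷ allSame) + 𝟙 (ks j ==ᴷ twoSame) + 𝟙 (ks j ==ᴷ allDifferent))
    ≡⟨ sum-cong-≗ (λ j → one-kind (ks j)) ⟩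
  sum {r} (λ _ → 1)
    ≡⟨ sum-ones r ⟩
  r ∎
  where
  open ≡-Reasoning
  one-kind : ∀ k → 𝟙 (k ==ᴷ allSame) + 𝟙 (k ==ᴷ twoSame) + 𝟙 (k ==ᴷ allDifferent) ≡ 1
  one-kind allSame      = refl
  one-kind twoSame      = refl
  one-kind allDifferent = refl

data Agreements : Bool → Bool → Bool → Set where
  all-equal    : Agreements true  true  true
  equal₁₂      : Agreements true  false false
  equal₁₃      : Agreements false true  false
  equal₂₃      : Agreements false false true
  all-distinct : Agreements false false false

agreements : ∀ {n} (p q s : Fin n) → Agreements (p == q) (p == s) (q == s)
agreements p q s with p ≟ q | p ≟ s | q ≟ s
... | yes refl | yes refl | yes _    = all-equal
... | yes refl | yes refl | no q≢s   = contradiction refl q≢s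
... | yes refl | no p≢s   | yes q≡s  = contradiction q≡s p≢s
... | yes refl | no _     | no _     = equal₁₂
... | no p≢q   | yes refl | yes q≡s  = contradiction (sym q≡s) p≢q
... | no _     | yes refl | no _     = equal₁₃
... | no _     | no _     | yes refl = equal₂₃
... | no _     | no _     | no _     = all-distinct

kind : ∀ {a b c} → Agreements a b c → Kind
kind all-equal    = allSame
kind equal₁₂      = twoSame
kind equal₁₃      = twoSame
kind equal₂₃      = twoSame
kind all-distinct = allDifferent

all-equal-count : ∀ {a b c} (ag : Agreements a b c) → 𝟙 (a ∧ b) ≡ 𝟙 (kind ag ==ᴷ allSame)
all-equal-count all-equal    = refl
all-equal-count equal₁₂      = refl
all-equal-count equal₁₃      = refl
all-equal-count equal₂₃      = refl
all-equal-count all-distinct = refl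

two-equal-count : ∀ {a b c} (ag : Agreements a b c) →
                  𝟙 (a ∧ not b) + 𝟙 (b ∧ not a) + 𝟙 (c ∧ not a) ≡ 𝟙 (kind ag ==ᴷ twoSame)
two-equal-count all-equal    = refl
two-equal-count equal₁₂      = refl
two-equal-count equal₁₃      = refl
two-equal-count equal₂₃      = refl
two-equal-count all-distinct = refl

degree : Bool × Bool × Bool → ℕ
degree (b₁ , b₂ , b₃) = 𝟙 b₁ + 𝟙 b₂ + 𝟙 b₃

-- The number of vertices of degree > κ in a part of the given kind.
cost : Kind → ℕ → ℕ
cost allSame      κ = 𝟙 (κ <ᵇ 3)
cost twoSame      κ = 𝟙 (κ <ᵇ 2) + 𝟙 (κ <ᵇ 1)
cost allDifferent κ = 𝟙 (κ <ᵇ 1) + 𝟙 (κ <ᵇ 1) + 𝟙 (κ <ᵇ 1)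

-- The left side lists the three points of a part, each counted only if no earlier point equals it.
heavy-count≡cost : ∀ {a b c} (ag : Agreements a b c) κ →
  𝟙 (κ <ᵇ degree (true , a , b)) + 𝟙 (not a ∧ (κ <ᵇ degree (a , true , c)))
    + 𝟙 (not b ∧ (not c ∧ (κ <ᵇ degree (b , c , true)))) ≡ cost (kind ag) κ
heavy-count≡cost all-equal    κ = trans (+-identityʳ _) (+-identityʳ _)
heavy-count≡cost equal₁₂      κ = cong (_+ 𝟙 (κ <ᵇ 1)) (+-identityʳ (𝟙 (κ <ᵇ 2)))
heavy-count≡cost equal₁₃      κ = +-identityʳ _
heavy-count≡cost equal₂₃      κ = trans (+-identityʳ _) (+-comm (𝟙 (κ <ᵇ 1)) (𝟙 (κ <ᵇ 2)))
heavy-count≡cost all-distinct κ = refl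

𝟙-by-first-member : ∀ b₁ b₂ b₃ w → (w ≡ true → b₁ ∨ b₂ ∨ b₃ ≡ true) →
  𝟙 w ≡ 𝟙 (b₁ ∧ w) + 𝟙 (b₂ ∧ (not b₁ ∧ w)) + 𝟙 (b₃ ∧ (not b₁ ∧ (not b₂ ∧ w)))
𝟙-by-first-member true  true  true  false _ = refl
𝟙-by-first-member true  true  false false _ = refl
𝟙-by-first-member true  false true  false _ = refl
𝟙-by-first-member true  false false false _ = refl
𝟙-by-first-member false true  true  false _ = refl
𝟙-by-first-member false true  false false _ = refl
𝟙-by-first-member false false true  false _ = refl
𝟙-by-first-member false false false false _ = refl
𝟙-by-first-member true  true  true  true  _ = refl
𝟙-by-first-member true  true  false true  _ = refl
𝟙-by-first-member true  false true  true  _ = refl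
𝟙-by-first-member true  false false true  _ = refl
𝟙-by-first-member false true  true  true  _ = refl
𝟙-by-first-member false true  false true  _ = refl
𝟙-by-first-member false false true  true  _ = refl
𝟙-by-first-member false false false true  h with () ← h refl

-- κ j is the largest degree allowed for an uncovered vertex of part j.
record Achievable {r} (ks : Fin r → Kind) (w c : ℕ) : Set where
  constructor achieved
  field
    κ        : Fin r → ℕ
    sum-κ    : sum κ ≡ w
    sum-cost : sum (λ j → cost (ks j) (κ j)) ≡ c

achievable-∷ : ∀ {r} k (ks : Fin r → Kind) {w c} κ₀ →
               Achievable ks w c → Achievable (k Vector.∷ ks) (κ₀ + w) (cost k κ₀ + c)
achievable-∷ k ks κ₀ (achieved κ sum-κ sum-cost) =
  achieved (κ₀ Vector.∷ κ) (cong (κ₀ +_) sum-κ) (cong (cost k κ₀ +_) sum-cost)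

achievable-cast : ∀ {r} {ks : Fin r → Kind} {w w' c c'} → w ≡ w' → c ≡ c' →
                  Achievable ks w c → Achievable ks w' c'
achievable-cast refl refl a = a

achievable-≗ : ∀ {r} {ks ks' : Fin r → Kind} {w c} → ks ≗ ks' → Achievable ks w c → Achievable ks' w c
achievable-≗ ks≗ks' (achieved κ sum-κ sum-cost) =
  achieved κ sum-κ (trans (sum-cong-≗ (λ j → cong (λ k → cost k (κ j)) (sym (ks≗ks' j)))) sum-cost)

-- a + a', b + b' and c + c' split the allDifferent parts, the halves of the twoSame parts and the
-- allSame parts into uncovered ones (weight 1, 1, 3 each) and covered ones (cost 3, 1, 1 each).
achievable : ∀ {r} (ks : Fin r → Kind) a a' b b' c c' →
  a + a' ≡ count ks allDifferent → b + b' ≡ 2 * count ks twoSame → c + c' ≡ count ks allSame →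
  Achievable ks (a + b + 3 * c) (3 * a' + b' + c')
achievable {zero} ks a a' b b' c c' ea eb ec
  rewrite m+n≡0⇒m≡0 a ea | m+n≡0⇒n≡0 a ea | m+n≡0⇒m≡0 b eb | m+n≡0⇒n≡0 b eb
        | m+n≡0⇒m≡0 c ec | m+n≡0⇒n≡0 c ec = achieved (λ ()) refl refl
achievable {suc r} ks a a' b b' c c' ea eb ec =
  achievable-≗ (λ { zero → refl ; (suc j) → refl }) (extend (ks zero) a a' b b' c c' ea eb ec)
  where
  tail : Fin r → Kind
  tail = ks ∘ suc
  extend : ∀ k a a' b b' c c' →
    a + a' ≡ 𝟙 (k ==ᴷ allDifferent) + count tail allDifferent →
    b + b' ≡ 2 * (𝟙 (k ==ᴷ twoSame) + count tail twoSame) →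
    c + c' ≡ 𝟙 (k ==ᴷ allSame) + count tail allSame →
    Achievable (k Vector.∷ tail) (a + b + 3 * c) (3 * a' + b' + c')
  extend allDifferent (suc a) a' b b' c c' ea eb ec =
    achievable-∷ allDifferent tail 1 (achievable tail a a' b b' c c' (suc-injective ea) eb ec)
  extend allDifferent zero (suc a') b b' c c' ea eb ec =
    achievable-cast refl (three-more a' b' c')
      (achievable-∷ allDifferent tail 0 (achievable tail 0 a' b b' c c' (suc-injective ea) eb ec))
    where three-more : ∀ x y z → 3 + (3 * x + y + z) ≡ 3 * suc x + y + z
          three-more = solve-∀
  extend allSame a a' b b' (suc c) c' ea eb ec =
    achievable-cast (three-more a b c) refl
      (achievable-∷ allSame tail 3 (achievable tail a a' b b' c c' ea eb (suc-injective ec)))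
    where three-more : ∀ x y z → 3 + (x + y + 3 * z) ≡ x + y + 3 * suc z
          three-more = solve-∀
  extend allSame a a' b b' zero (suc c') ea eb ec =
    achievable-cast refl (one-more a' b' c')
      (achievable-∷ allSame tail 0 (achievable tail a a' b b' 0 c' ea eb (suc-injective ec)))
    where one-more : ∀ x y z → 1 + (3 * x + y + z) ≡ 3 * x + y + suc z
          one-more = solve-∀
  extend twoSame a a' b b' c c' ea eb ec = pairs b b' (trans eb (*-suc 2 _))
    where
    more : ∀ k x y z → k + (x + y + z) ≡ x + (k + y) + z
    more = solve-∀
    pairs : ∀ b b' → b + b' ≡ 2 + 2 * count tail twoSame →
            Achievable (twoSame Vector.∷ tail) (a + b + 3 * c) (3 * a' + b' + c')
    pairs (suc (suc b)) b' eb' =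
      achievable-cast (more 2 a b (3 * c)) refl
        (achievable-∷ twoSame tail 2 (achievable tail a a' b b' c c' ea (suc-injective (suc-injective eb')) ec))
    pairs (suc zero) (suc b') eb' =
      achievable-cast (more 1 a 0 (3 * c)) (more 1 (3 * a') b' c')
        (achievable-∷ twoSame tail 1 (achievable tail a a' 0 b' c c' ea (suc-injective (suc-injective eb')) ec))
    pairs zero (suc (suc b')) eb' =
      achievable-cast refl (more 2 (3 * a') b' c')
        (achievable-∷ twoSame tail 0 (achievable tail a a' 0 b' c c' ea (suc-injective (suc-injective eb')) ec))

CoverBound : ℕ → ℕ → ℕ → ℕ → ℕ → Set
CoverBound t τ t₁ t₂ d = ∀ a a' b b' c c' → a + a' ≡ d → b + b' ≡ 2 * t₂ → c + c' ≡ t₁ →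
                         a + b + 3 * c < 3 * t → τ ≤ 3 * a' + b' + c'

-- Leave all allDifferent and twoSame parts uncovered and ⌊W/3⌋ allSame parts, W the weight left.
τ-bound-many-common : ∀ {t τ t₁ t₂ d} → CoverBound t τ t₁ t₂ d → 3 * t ≤ t₁ + t₂ + d →
  t₁ + t₂ + d + 1 + t₂ ≤ t₁ + 3 * t → 3 * τ + 3 * t ≤ 2 * t₁ + t₂ + (t₁ + t₂ + d) + 3
τ-bound-many-common {t} {τ} {t₁} {t₂} {d} cover 3t≤t₁+t₂+d h = begin
  3 * τ + 3 * t                             ≤⟨ +-monoˡ-≤ (3 * t) (*-monoʳ-≤ 3 τ≤c') ⟩
  3 * c' + 3 * t                            ≡⟨ cong (3 * c' +_) (trans (sym eW) (cong (suc (d + 2 * t₂) +_) W≡)) ⟩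
  3 * c' + (suc (d + 2 * t₂) + (ρ + q * 3)) ≡⟨ regroup c' d t₂ ρ q ⟩
  3 * (q + c') + d + 2 * t₂ + 1 + ρ         ≤⟨ +-monoʳ-≤ _ ρ≤2 ⟩
  3 * (q + c') + d + 2 * t₂ + 1 + 2         ≡⟨ cong (λ x → 3 * x + d + 2 * t₂ + 1 + 2) ec' ⟩
  3 * t₁ + d + 2 * t₂ + 1 + 2               ≡⟨ finish t₁ t₂ d ⟩
  2 * t₁ + t₂ + (t₁ + t₂ + d) + 3           ∎
  where
  open ≤-Reasoning
  shape : ∀ t₁ t₂ d → t₁ + t₂ + d + 1 + t₂ ≡ t₁ + suc (d + 2 * t₂)
  shape = solve-∀
  regroup : ∀ c' d t₂ ρ q → 3 * c' + (suc (d + 2 * t₂) + (ρ + q * 3)) ≡ 3 * (q + c') + d + 2 * t₂ + 1 + ρ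
  regroup = solve-∀
  finish : ∀ t₁ t₂ d → 3 * t₁ + d + 2 * t₂ + 1 + 2 ≡ 2 * t₁ + t₂ + (t₁ + t₂ + d) + 3
  finish = solve-∀
  split : ∀ t₂ d W → suc (d + 2 * t₂) + W ≡ (t₂ + d) + suc (t₂ + W)
  split = solve-∀
  rotate : ∀ t₁ t₂ d → t₁ + t₂ + d ≡ t₂ + d + t₁
  rotate = solve-∀
  W q ρ c' : ℕ
  W  = 3 * t ∸ suc (d + 2 * t₂)
  q  = W / 3
  ρ  = W % 3
  c' = t₁ ∸ q
  eW : suc (d + 2 * t₂) + W ≡ 3 * t
  eW = m+[n∸m]≡n (+-cancelˡ-≤ t₁ _ _ (subst (_≤ t₁ + 3 * t) (shape t₁ t₂ d) h))
  W≡ : W ≡ ρ + q * 3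
  W≡ = m≡m%n+[m/n]*n W 3
  ρ≤2 : ρ ≤ 2
  ρ≤2 = ≤-pred (m%n<n W 3)
  W≤t₁ : W ≤ t₁
  W≤t₁ = ≤-trans (m≤n+m W t₂) (≤-trans (n≤1+n _) (+-cancelˡ-≤ (t₂ + d) _ _ (begin
    t₂ + d + suc (t₂ + W)   ≡⟨ split t₂ d W ⟨
    suc (d + 2 * t₂) + W    ≡⟨ eW ⟩
    3 * t                   ≤⟨ 3t≤t₁+t₂+d ⟩
    t₁ + t₂ + d             ≡⟨ rotate t₁ t₂ d ⟩
    t₂ + d + t₁             ∎)))
  ec' : q + c' ≡ t₁
  ec' = m+[n∸m]≡n (≤-trans (m/n≤m W 3) W≤t₁)
  slack : d + 2 * t₂ + 3 * q < 3 * t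
  slack = begin-strict
    d + 2 * t₂ + 3 * q    ≤⟨ +-monoʳ-≤ (d + 2 * t₂) (subst (_≤ W) (*-comm q 3) (m/n*n≤m W 3)) ⟩
    d + 2 * t₂ + W        <⟨ ≤-refl ⟩
    suc (d + 2 * t₂) + W  ≡⟨ eW ⟩
    3 * t                 ∎
  τ≤c' : τ ≤ c'
  τ≤c' = cover d 0 (2 * t₂) 0 q c' (+-identityʳ d) (+-identityʳ _) ec' slack

-- Leave all allDifferent parts uncovered and spend the remaining weight on halves of twoSame parts.
τ-bound-some-common : ∀ {t τ t₁ t₂ d} → CoverBound t τ t₁ t₂ d →
  t₁ + t₂ + d + 1 ≤ t₁ + t₂ + 3 * t → t₁ + 3 * t ≤ t₁ + t₂ + d + 1 + t₂ →
  τ + 3 * t ≤ t₁ + t₂ + d + 1 + t₂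
τ-bound-some-common {t} {τ} {t₁} {t₂} {d} cover h₁ h₂ = begin
  τ + 3 * t                    ≤⟨ +-monoˡ-≤ (3 * t) τ≤ ⟩
  b' + t₁ + 3 * t              ≡⟨ cong (b' + t₁ +_) eb ⟨
  b' + t₁ + (suc d + b)        ≡⟨ regroup b' t₁ d b ⟩
  t₁ + suc d + (b + b')        ≡⟨ cong (t₁ + suc d +_) eb' ⟩
  t₁ + suc d + 2 * t₂          ≡⟨ finish t₁ t₂ d ⟩
  t₁ + t₂ + d + 1 + t₂         ∎
  where
  open ≤-Reasoning
  shape₁ : ∀ t₁ t₂ d → t₁ + t₂ + d + 1 ≡ t₁ + t₂ + suc d
  shape₁ = solve-∀
  shape₂ : ∀ t₁ t₂ d → t₁ + t₂ + d + 1 + t₂ ≡ t₁ + (suc d + 2 * t₂)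
  shape₂ = solve-∀
  regroup : ∀ b' t₁ d b → b' + t₁ + (suc d + b) ≡ t₁ + suc d + (b + b')
  regroup = solve-∀
  finish : ∀ t₁ t₂ d → t₁ + suc d + 2 * t₂ ≡ t₁ + t₂ + d + 1 + t₂
  finish = solve-∀
  b b' : ℕ
  b  = 3 * t ∸ suc d
  b' = 2 * t₂ ∸ b
  eb : suc d + b ≡ 3 * t
  eb = m+[n∸m]≡n (+-cancelˡ-≤ (t₁ + t₂) _ _ (subst (_≤ t₁ + t₂ + 3 * t) (shape₁ t₁ t₂ d) h₁))
  b≤2t₂ : b ≤ 2 * t₂
  b≤2t₂ = +-cancelˡ-≤ (suc d) _ _ (begin
    suc d + b          ≡⟨ eb ⟩
    3 * t              ≤⟨ +-cancelˡ-≤ t₁ _ _ (subst (t₁ + 3 * t ≤_) (shape₂ t₁ t₂ d) h₂) ⟩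
    suc d + 2 * t₂     ∎)
  eb' : b + b' ≡ 2 * t₂
  eb' = m+[n∸m]≡n b≤2t₂
  τ≤ : τ ≤ b' + t₁
  τ≤ = cover d 0 b b' 0 t₁ (+-identityʳ d) eb' refl
         (≤-reflexive (trans (cong suc (+-identityʳ (d + b))) eb))

-- Spend the whole weight 3t − 1 on allDifferent parts.
τ-bound-few-common : ∀ {t τ t₁ t₂ d} → CoverBound t τ t₁ t₂ d → 1 ≤ t →
  t₁ + t₂ + 3 * t ≤ t₁ + t₂ + d + 1 → τ + 2 * t₁ + t₂ + 9 * t ≤ 3 * (t₁ + t₂ + d) + 3
τ-bound-few-common {t} {τ} {t₁} {t₂} {d} cover 1≤t h = begin
  τ + 2 * t₁ + t₂ + 9 * t                         ≤⟨ +-monoˡ-≤ (9 * t) (+-monoˡ-≤ t₂ (+-monoˡ-≤ (2 * t₁) τ≤)) ⟩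
  3 * a' + 2 * t₂ + t₁ + 2 * t₁ + t₂ + 9 * t      ≡⟨ regroup a' t₂ t₁ t ⟩
  3 * (t₁ + t₂ + a') + 3 * (3 * t)                ≡⟨ cong (λ x → 3 * (t₁ + t₂ + a') + 3 * x) ea ⟨
  3 * (t₁ + t₂ + a') + 3 * (1 + a)                ≡⟨ finish t₁ t₂ a a' ⟩
  3 * (t₁ + t₂ + (a + a')) + 3                    ≡⟨ cong (λ x → 3 * (t₁ + t₂ + x) + 3) ed ⟩
  3 * (t₁ + t₂ + d) + 3                           ∎
  where
  open ≤-Reasoning
  shape : ∀ t₁ t₂ d → t₁ + t₂ + d + 1 ≡ t₁ + t₂ + suc d
  shape = solve-∀
  regroup : ∀ a' t₂ t₁ t → 3 * a' + 2 * t₂ + t₁ + 2 * t₁ + t₂ + 9 * t ≡ 3 * (t₁ + t₂ + a') + 3 * (3 * t)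
  regroup = solve-∀
  finish : ∀ t₁ t₂ a a' → 3 * (t₁ + t₂ + a') + 3 * (1 + a) ≡ 3 * (t₁ + t₂ + (a + a')) + 3
  finish = solve-∀
  a a' : ℕ
  a  = 3 * t ∸ 1
  a' = d ∸ a
  ea : 1 + a ≡ 3 * t
  ea = m+[n∸m]≡n (≤-trans 1≤t (m≤n*m t 3))
  a≤d : a ≤ d
  a≤d = ≤-pred (subst (_≤ suc d) (sym ea)
          (+-cancelˡ-≤ (t₁ + t₂) _ _ (subst (t₁ + t₂ + 3 * t ≤_) (shape t₁ t₂ d) h)))
  ed : a + a' ≡ d
  ed = m+[n∸m]≡n a≤d
  τ≤ : τ ≤ 3 * a' + 2 * t₂ + t₁
  τ≤ = cover a a' 0 (2 * t₂) 0 t₁ ed refl refl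
         (≤-reflexive (trans (cong suc (trans (+-identityʳ (a + 0)) (+-identityʳ a))) ea))

CoverNumberBounds : ℕ → ℕ → ℕ → ℕ → ℕ → Set
CoverNumberBounds r t τ t₁ t₂ =
    (r + 1 + t₂ ≤ t₁ + 3 * t × t₁ ≤ r → 3 * τ + 3 * t ≤ 2 * t₁ + t₂ + r + 3)
  × (r + 1 ≤ t₁ + t₂ + 3 * t × t₁ + 3 * t ≤ r + 1 + t₂ → τ + 3 * t ≤ r + 1 + t₂)
  × (t₁ + t₂ + 3 * t ≤ r + 1 → τ + 2 * t₁ + t₂ + 9 * t ≤ 3 * r + 3)

bounds : ∀ {r t τ t₁ t₂ d} → 1 ≤ t → 3 * t ≤ r → t₁ + t₂ + d ≡ r → CoverBound t τ t₁ t₂ d →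
         CoverNumberBounds r t τ t₁ t₂
bounds {t = t} 1≤t 3t≤r refl cover =
    (λ (h , _) → τ-bound-many-common {t} cover 3t≤r h)
  , (λ (h₁ , h₂) → τ-bound-some-common {t} cover h₁ h₂)
  , τ-bound-few-common {t} cover 1≤t

module ThreeEdges {n r} {part : Fin n → Fin r} {e₁ e₂ e₃ : Fin n → Bool}
                  (σ₁ : Transversal part e₁) (σ₂ : Transversal part e₂) (σ₃ : Transversal part e₃) where

  x₁ x₂ x₃ : Fin r → Fin n
  x₁ = pick σ₁
  x₂ = pick σ₂
  x₃ = pick σ₃

  kindAt : Fin r → Kind
  kindAt j = kind (agreements (x₁ j) (x₂ j) (x₃ j))

  membership : Fin n → Bool × Bool × Bool
  membership v = e₁ v , e₂ v , e₃ v

  membership-x₁ : ∀ j → membership (x₁ j) ≡ (true , x₁ j == x₂ j , x₁ j == x₃ j)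
  membership-x₁ j = cong₂ _,_ (pick-∈ σ₁ j)
    (cong₂ _,_ (trans (∈≡agree σ₂ σ₁ j) (==-sym (x₂ j) (x₁ j)))
               (trans (∈≡agree σ₃ σ₁ j) (==-sym (x₃ j) (x₁ j))))

  membership-x₂ : ∀ j → membership (x₂ j) ≡ (x₁ j == x₂ j , true , x₂ j == x₃ j)
  membership-x₂ j = cong₂ _,_ (∈≡agree σ₁ σ₂ j)
    (cong₂ _,_ (pick-∈ σ₂ j) (trans (∈≡agree σ₃ σ₂ j) (==-sym (x₃ j) (x₂ j))))

  membership-x₃ : ∀ j → membership (x₃ j) ≡ (x₁ j == x₃ j , x₂ j == x₃ j , true)
  membership-x₃ j = cong₂ _,_ (∈≡agree σ₁ σ₃ j) (cong₂ _,_ (∈≡agree σ₂ σ₃ j) (pick-∈ σ₃ j))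

  count-all-three : sum (λ v → 𝟙 (e₁ v ∧ (e₂ v ∧ e₃ v))) ≡ count kindAt allSame
  count-all-three = begin
    sum (λ v → 𝟙 (e₁ v ∧ (e₂ v ∧ e₃ v)))
      ≡⟨ count-via-pick σ₁ _ ⟩
    sum (λ j → 𝟙 (e₂ (x₁ j) ∧ e₃ (x₁ j)))
      ≡⟨ sum-cong-≗ (λ j → cong (λ { (_ , b₂ , b₃) → 𝟙 (b₂ ∧ b₃) }) (membership-x₁ j)) ⟩
    sum (λ j → 𝟙 ((x₁ j == x₂ j) ∧ (x₁ j == x₃ j)))
      ≡⟨ sum-cong-≗ (λ j → all-equal-count (agreements (x₁ j) (x₂ j) (x₃ j))) ⟩
    count kindAt allSame ∎
    where open ≡-Reasoning

  count-exactly-two :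
    sum (λ v → 𝟙 (e₁ v ∧ (e₂ v ∧ not (e₃ v)))) + sum (λ v → 𝟙 (e₁ v ∧ (e₃ v ∧ not (e₂ v))))
      + sum (λ v → 𝟙 (e₂ v ∧ (e₃ v ∧ not (e₁ v)))) ≡ count kindAt twoSame
  count-exactly-two = begin
    sum (λ v → 𝟙 (e₁ v ∧ (e₂ v ∧ not (e₃ v)))) + sum (λ v → 𝟙 (e₁ v ∧ (e₃ v ∧ not (e₂ v))))
      + sum (λ v → 𝟙 (e₂ v ∧ (e₃ v ∧ not (e₁ v))))
      ≡⟨ cong₂ _+_ (cong₂ _+_ (count-via-pick σ₁ _) (count-via-pick σ₁ _)) (count-via-pick σ₂ _) ⟩
    sum f₁₂ + sum f₁₃ + sum f₂₃
      ≡⟨ sum-distrib₃ f₁₂ f₁₃ f₂₃ ⟨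
    sum (λ j → f₁₂ j + f₁₃ j + f₂₃ j)
      ≡⟨ sum-cong-≗ at-part ⟩
    count kindAt twoSame ∎
    where
    open ≡-Reasoning
    f₁₂ f₁₃ f₂₃ : Fin r → ℕ
    f₁₂ j = 𝟙 (e₂ (x₁ j) ∧ not (e₃ (x₁ j)))
    f₁₃ j = 𝟙 (e₃ (x₁ j) ∧ not (e₂ (x₁ j)))
    f₂₃ j = 𝟙 (e₃ (x₂ j) ∧ not (e₁ (x₂ j)))
    at-part : ∀ j → f₁₂ j + f₁₃ j + f₂₃ j ≡ 𝟙 (kindAt j ==ᴷ twoSame)
    at-part j = trans
      (cong₂ (λ { (_ , b₂ , b₃) (b₁ , _ , b₃') → 𝟙 (b₂ ∧ not b₃) + 𝟙 (b₃ ∧ not b₂) + 𝟙 (b₃' ∧ not b₁) })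
             (membership-x₁ j) (membership-x₂ j))
      (two-equal-count (agreements (x₁ j) (x₂ j) (x₃ j)))

  covered : (Fin r → ℕ) → Fin n → Bool
  covered κ v = κ (part v) <ᵇ degree (membership v)

  count-covered : ∀ κ → sum (λ v → 𝟙 (covered κ v)) ≡ sum (λ j → cost (kindAt j) (κ j))
  count-covered κ = begin
    sum (λ v → 𝟙 (covered κ v))
      ≡⟨ sum-cong-≗ (λ v → 𝟙-by-first-member (e₁ v) (e₂ v) (e₃ v) (covered κ v) (member v)) ⟩
    sum (λ v → 𝟙 (e₁ v ∧ g₁ v) + 𝟙 (e₂ v ∧ g₂ v) + 𝟙 (e₃ v ∧ g₃ v))
      ≡⟨ sum-distrib₃ (λ v → 𝟙 (e₁ v ∧ g₁ v)) (λ v → 𝟙 (e₂ v ∧ g₂ v)) (λ v → 𝟙 (e₃ v ∧ g₃ v)) ⟩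
    sum (λ v → 𝟙 (e₁ v ∧ g₁ v)) + sum (λ v → 𝟙 (e₂ v ∧ g₂ v)) + sum (λ v → 𝟙 (e₃ v ∧ g₃ v))
      ≡⟨ cong₂ _+_ (cong₂ _+_ (count-via-pick σ₁ g₁) (count-via-pick σ₂ g₂)) (count-via-pick σ₃ g₃) ⟩
    sum (𝟙 ∘ g₁ ∘ x₁) + sum (𝟙 ∘ g₂ ∘ x₂) + sum (𝟙 ∘ g₃ ∘ x₃)
      ≡⟨ sum-distrib₃ (𝟙 ∘ g₁ ∘ x₁) (𝟙 ∘ g₂ ∘ x₂) (𝟙 ∘ g₃ ∘ x₃) ⟨
    sum (λ j → 𝟙 (g₁ (x₁ j)) + 𝟙 (g₂ (x₂ j)) + 𝟙 (g₃ (x₃ j)))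
      ≡⟨ sum-cong-≗ at-part ⟩
    sum (λ j → cost (kindAt j) (κ j)) ∎
    where
    open ≡-Reasoning
    g₁ g₂ g₃ : Fin n → Bool
    g₁ v = covered κ v
    g₂ v = not (e₁ v) ∧ covered κ v
    g₃ v = not (e₁ v) ∧ (not (e₂ v) ∧ covered κ v)
    member : ∀ v → covered κ v ≡ true → e₁ v ∨ e₂ v ∨ e₃ v ≡ true
    member v with e₁ v | e₂ v | e₃ v
    ... | true  | _     | _     = λ _ → refl
    ... | false | true  | _     = λ _ → refl
    ... | false | false | true  = λ _ → refl
    ... | false | false | false = λ ()
    at-part : ∀ j → 𝟙 (g₁ (x₁ j)) + 𝟙 (g₂ (x₂ j)) + 𝟙 (g₃ (x₃ j)) ≡ cost (kindAt j) (κ j)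
    at-part j = begin
      𝟙 (g₁ (x₁ j)) + 𝟙 (g₂ (x₂ j)) + 𝟙 (g₃ (x₃ j))
        ≡⟨ cong₂ _+_ (cong₂ _+_
             (cong₂ (λ k m → 𝟙 (k <ᵇ degree m)) (cong κ (part-pick σ₁ j)) (membership-x₁ j))
             (cong₂ (λ k m → 𝟙 (not (proj₁ m) ∧ (k <ᵇ degree m))) (cong κ (part-pick σ₂ j)) (membership-x₂ j)))
             (cong₂ (λ k m → 𝟙 (not (proj₁ m) ∧ (not (proj₁ (proj₂ m)) ∧ (k <ᵇ degree m))))
                    (cong κ (part-pick σ₃ j)) (membership-x₃ j)) ⟩
      _ ≡⟨ heavy-count≡cost (agreements (x₁ j) (x₂ j) (x₃ j)) (κ j) ⟩
      cost (kindAt j) (κ j) ∎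

  degree-off-cover : ∀ κ {f} (σ : Transversal part f) → (∀ v → f v ≡ true → covered κ v ≡ false) →
                     ∀ j → degree (membership (pick σ j)) ≤ κ j
  degree-off-cover κ σ avoids j = subst (degree (membership (pick σ j)) ≤_) (cong κ (part-pick σ j))
    (<ᵇ≡false⇒≤ _ _ (avoids (pick σ j) (pick-∈ σ j)))

  sum-degree : ∀ {f} (σ : Transversal part f) →
    sum (λ j → degree (membership (pick σ j)))
      ≡ sum (λ v → 𝟙 (f v ∧ e₁ v)) + sum (λ v → 𝟙 (f v ∧ e₂ v)) + sum (λ v → 𝟙 (f v ∧ e₃ v))
  sum-degree σ = trans (sum-distrib₃ (𝟙 ∘ e₁ ∘ pick σ) (𝟙 ∘ e₂ ∘ pick σ) (𝟙 ∘ e₃ ∘ pick σ))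
    (sym (cong₂ _+_ (cong₂ _+_ (count-via-pick σ e₁) (count-via-pick σ e₂)) (count-via-pick σ e₃)))

module _ (H : Hypergraph) {r} {part : Fin (n H) → Fin r} (σ : ∀ k → Transversal part (lookup (E H k)))
         (i₁ i₂ i₃ : Fin (m H)) where
  open ThreeEdges (σ i₁) (σ i₂) (σ i₃)

  covers-with-slack : ∀ {t} → Intersecting t H → ∀ κ → sum κ < 3 * t → IsCover H (tabulate (covered κ))
  covers-with-slack {t} meets κ slack k with any? (λ v → covered κ v ∧ lookup (E H k) v Bool.≟ true)
  ... | yes (v , hit) = v , lookup⇒[]= v _ (trans (lookup∘tabulate (covered κ) v) (Bool.∧-conicalˡ _ _ hit))
                          , lookup⇒[]= v (E H k) (Bool.∧-conicalʳ _ _ hit)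
  ... | no miss = contradiction slack (≤⇒≯ (begin
    3 * t
      ≡⟨ triple t ⟩
    t + t + t
      ≤⟨ +-mono-≤ (+-mono-≤ (meets k i₁) (meets k i₂)) (meets k i₃) ⟩
    ∣ E H k ∩ E H i₁ ∣ + ∣ E H k ∩ E H i₂ ∣ + ∣ E H k ∩ E H i₃ ∣
      ≡⟨ cong₂ _+_ (cong₂ _+_ (∣p∩q∣≡sum (E H k) (E H i₁)) (∣p∩q∣≡sum (E H k) (E H i₂)))
                   (∣p∩q∣≡sum (E H k) (E H i₃)) ⟩
    _ ≡⟨ sum-degree (σ k) ⟨
    sum (λ j → degree (membership (pick (σ k) j)))
      ≤⟨ sum-mono-≤ (degree-off-cover κ (σ k) avoids) ⟩
    sum κ ∎))
    where
    open ≤-Reasoning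
    triple : ∀ t → 3 * t ≡ t + t + t
    triple = solve-∀
    avoids : ∀ v → lookup (E H k) v ≡ true → covered κ v ≡ false
    avoids v v∈k with covered κ v in c
    ... | true  = contradiction (v , cong₂ _∧_ c v∈k) miss
    ... | false = refl

  ∣e₁∩e₂∩e₃∣≡count : ∣ E H i₁ ∩ E H i₂ ∩ E H i₃ ∣ ≡ count kindAt allSame
  ∣e₁∩e₂∩e₃∣≡count = trans (∣p∩q∩s∣≡sum (E H i₁) (E H i₂) (E H i₃)) count-all-three

  t₂≡count : ∣ (E H i₁ ∩ E H i₂) ─ E H i₃ ∣ + ∣ (E H i₁ ∩ E H i₃) ─ E H i₂ ∣
               + ∣ (E H i₂ ∩ E H i₃) ─ E H i₁ ∣ ≡ count kindAt twoSame
  t₂≡count = trans (cong₂ _+_ (cong₂ _+_ (∣p∩q─s∣≡sum (E H i₁) (E H i₂) (E H i₃))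
                                         (∣p∩q─s∣≡sum (E H i₁) (E H i₃) (E H i₂)))
                               (∣p∩q─s∣≡sum (E H i₂) (E H i₃) (E H i₁)))
                   count-exactly-two

  cover-bound : ∀ {t τ} → Intersecting t H → (∀ C → IsCover H C → τ ≤ ∣ C ∣) →
                CoverBound t τ (count kindAt allSame) (count kindAt twoSame) (count kindAt allDifferent)
  cover-bound {t} {τ} meets minimal a a' b b' c c' ea eb ec slack = begin
    τ                                   ≤⟨ minimal C (covers-with-slack meets κ (subst (_< 3 * t) (sym sum-κ) slack)) ⟩
    ∣ C ∣                               ≡⟨ ∣p∣≡sum C ⟩
    sum (λ v → 𝟙 (lookup C v))          ≡⟨ sum-cong-≗ (cong 𝟙 ∘ lookup∘tabulate (covered κ)) ⟩
    sum (λ v → 𝟙 (covered κ v))         ≡⟨ count-covered κ ⟩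
    sum (λ j → cost (kindAt j) (κ j))   ≡⟨ sum-cost ⟩
    3 * a' + b' + c'                    ∎
    where
    open ≤-Reasoning
    open Achievable (achievable kindAt a a' b b' c c' ea eb ec)
    C : Subset (n H)
    C = tabulate (covered κ)

partite-transversals : ∀ {r} (H : Hypergraph) (part : Fin (n H) → Fin r) →
                       (∀ k j → ∣ E H k ∩ Part part j ∣ ≡ 1) → ∀ k → Transversal part (lookup (E H k))
partite-transversals H part one-per-part k = transversal part (lookup (E H k))
  (λ j → trans (sym (∣p∩Part∣≡sum (E H k) part j)) (one-per-part k j))

lemma2p7 : (r t : ℕ) → 1 ≤ t → 3 * t ≤ r → (H : Hypergraph) → RTGraph r t H →
    (i₁ i₂ i₃ : Fin (m H)) → (τ : ℕ) → IsCoverNumber H τ →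
    let e₁ = E H i₁
        e₂ = E H i₂
        e₃ = E H i₃
        t₁ = ∣ e₁ ∩ e₂ ∩ e₃ ∣
        t₂ = ∣ (e₁ ∩ e₂) ─ e₃ ∣ + ∣ (e₁ ∩ e₃) ─ e₂ ∣ + ∣ (e₂ ∩ e₃) ─ e₁ ∣
    in ((r + 1 + t₂ ≤ t₁ + 3 * t × t₁ ≤ r → 3 * τ + 3 * t ≤ 2 * t₁ + t₂ + r + 3)
      × (r + 1 ≤ t₁ + t₂ + 3 * t × t₁ + 3 * t ≤ r + 1 + t₂ → τ + 3 * t ≤ r + 1 + t₂)
      × (t₁ + t₂ + 3 * t ≤ r + 1 → τ + 2 * t₁ + t₂ + 9 * t ≤ 3 * r + 3))
lemma2p7 r t 1≤t 3t≤r H (_ , (part , one-per-part) , meets) i₁ i₂ i₃ τ (_ , minimal) =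
  subst₂ (CoverNumberBounds r t τ) (sym (∣e₁∩e₂∩e₃∣≡count H σ i₁ i₂ i₃)) (sym (t₂≡count H σ i₁ i₂ i₃))
    (bounds 1≤t 3t≤r (count-partition kindAt) (cover-bound H σ i₁ i₂ i₃ meets minimal))
  where
  σ : ∀ k → Transversal part (lookup (E H k))
  σ = partite-transversals H part one-per-part
  open ThreeEdges (σ i₁) (σ i₂) (σ i₃) using (kindAt)
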